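{- Let $a_1,b_1,a_2,b_2$ be complex numbers, $p_1,p_2$ non-negative integers, and $k,\mu$ arbitrary non-negative integers. Then $$\binom{k+\mu}{k}S_{a_1,b_1}^{a_2,b_2,p_2}(p_1,k+\mu)=\sum_{j_2=0}^{p_2}\sum_{j_1=0}^{p_1}\binom{p_1}{j_1}\binom{p_2}{j_2}S_{a_1,0}^{a_2,0,p_2-j_2}(p_1-j_1,\mu)\,S_{a_1,b_1}^{a_2,b_2,j_2}(j_1,k).$$
   Context: For complex numbers $a_1,b_1,a_2,b_2$, non-negative integers $p_1,p_2$ and a non-negative integer $k$, the generalized Stirling number of the second kind is $$S_{a_1,b_1}^{a_2,b_2,p_2}(p_1,k)=\frac{1}{k!}\sum_{j=0}^{k}(-1)^j\binom{k}{j}\bigl(a_1(k-j)+b_1\bigr)^{p_1}\bigl(a_2(k-j)+b_2\bigr)^{p_2},$$ with $0^0=1$. -}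

module Defs where

open import Level using (Level)
open import Data.Nat as ℕ using (ℕ; zero; suc; _∸_)
open import Data.Nat.Combinatorics using (_C_)
open import Data.Nat using (_!)
open import Algebra.Bundles using (CommutativeRing; Semiring)
import Algebra.Definitions.RawSemiring as RS

module GenStirling {c ℓ : Level} (R : CommutativeRing c ℓ) where
  open CommutativeRing R
  open RS (Semiring.rawSemiring semiring) using (_×_; _^_) public

  sumTo : ℕ → (ℕ → Carrier) → Carrier
  sumTo zero    f = f 0
  sumTo (suc n) f = sumTo n f + f (suc n)

  sign : ℕ → Carrier
  sign j = (- 1#) ^ j

  IsInvFact : ℕ → Carrier → Set ℓ
  IsInvFact k x = ((k !) × 1#) * x ≈ 1#

  -- Generalized Stirling number S_{a1,b1}^{a2,b2,p2}(p1,k), where invFact k = 1/k!.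
  -- Powers use _^_ with x ^ 0 = 1#, so 0^0 = 1.
  S : (invFact : ℕ → Carrier) (a₁ b₁ a₂ b₂ : Carrier) (p₂ p₁ k : ℕ) → Carrier
  S invFact a₁ b₁ a₂ b₂ p₂ p₁ k =
    invFact k * sumTo k (λ j →
      sign j * (((k C j) × 1#) *
        (((a₁ * ((k ∸ j) × 1#) + b₁) ^ p₁) * ((a₂ * ((k ∸ j) × 1#) + b₂) ^ p₂))))

-- Write f(z) = (a₁z + b₁)^p₁ (a₂z + b₂)^p₂ and let Δ be the forward difference on ℕ.
-- The defining sum says S(p₁,k) = Δᵏ f(0) / k!.  Since Δ^(k+μ) f(0) = Δᵏ_y Δ^μ_t f(t + y) at
-- t = y = 0, and the binomial theorem splits f(t + y) into a sum of products g(t) h(y) with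
-- g of the shape of f at b₁ = b₂ = 0 and h of the shape of f with smaller exponents, linearity
-- of Δ turns Δ^(k+μ) f(0) into the double sum of the products μ!S(…,μ) k!S(…,k).
-- Finally C(k+μ,k) / (k+μ)! = 1 / (k! μ!).
module Submission where

open import Defs
open import Level using (Level)
open import Data.Nat as ℕ using (ℕ; zero; suc; _∸_; _≤_; z≤n; _!)
import Data.Nat.Properties as ℕ
open import Data.Nat.Combinatorics using (_C_; nCk+nC[k+1]≡[n+1]C[k+1]; k![n∸k]!∣n!)
open import Data.Nat.Combinatorics.Specification using (nCk≡n!/k![n-k]!; k>n⇒nCk≡0)
open import Data.Nat.DivMod using (m/n*n≡m)
open import Data.Fin.Base using (toℕ)
open import Function.Base using (_∘_)
open import Algebra.Bundles using (CommutativeRing)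
import Algebra.Properties.CommutativeSemiring.Binomial as Binomial
import Algebra.Properties.CommutativeSemigroup as CommutativeSemigroupProperties
import Algebra.Properties.Ring as RingProperties
import Algebra.Properties.Semiring.Exp as ExpProperties
import Algebra.Properties.Semiring.Mult as MultProperties
import Algebra.Properties.Semiring.Sum as SumProperties
import Algebra.Solver.CommutativeMonoid as CommutativeMonoidSolver
import Relation.Binary.Reasoning.Setoid as SetoidReasoning
open import Relation.Binary.PropositionalEquality as ≡ using (_≡_)

n!≡nCk*[k!*[n∸k]!] : ∀ {n k} → k ≤ n → n ! ≡ (n C k) ℕ.* (k ! ℕ.* (n ∸ k) !)
n!≡nCk*[k!*[n∸k]!] {n} {k} k≤n = ≡.trans
  (≡.sym (m/n*n≡m (k![n∸k]!∣n! k≤n)))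
  (≡.cong (ℕ._* (k ! ℕ.* (n ∸ k) !)) (≡.sym (nCk≡n!/k![n-k]! k≤n)))
  where instance _ = ℕ._!*_!≢0 k (n ∸ k)

module GenStirlingProperties {c ℓ : Level} (R : CommutativeRing c ℓ) where
  open CommutativeRing R
  open GenStirling R
  open SetoidReasoning setoid
  open RingProperties ring using (-1*x≈-x; -‿distribʳ-*)
  open ExpProperties semiring using (^-congˡ)
  open MultProperties semiring using (×-assoc-*; ×1-homo-*; ×-homo-+; ×-congˡ; ×-congʳ)
  open SumProperties semiring using (sum⁺-syntax; ∑-distrib-+; *-distribˡ-sum; *-distribʳ-sum)
  open CommutativeSemigroupProperties *-commutativeSemigroup using (x∙yz≈y∙xz)
  open CommutativeMonoidSolver *-commutativeMonoid using (solve; _⊜_) renaming (_⊕_ to _⊗_)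
  open CommutativeMonoidSolver +-commutativeMonoid using (_⊕_)
    renaming (solve to +-solve; _⊜_ to _⊜⁺_; id to ε)

  sumTo-cong : ∀ n {f g : ℕ → Carrier} → (∀ j → f j ≈ g j) → sumTo n f ≈ sumTo n g
  sumTo-cong zero    f≈g = f≈g 0
  sumTo-cong (suc n) f≈g = +-cong (sumTo-cong n f≈g) (f≈g (suc n))

  sumTo-cong-≤ : ∀ n {f g : ℕ → Carrier} → (∀ j → j ≤ n → f j ≈ g j) → sumTo n f ≈ sumTo n g
  sumTo-cong-≤ zero    f≈g = f≈g 0 z≤n
  sumTo-cong-≤ (suc n) f≈g =
    +-cong (sumTo-cong-≤ n (λ j j≤n → f≈g j (ℕ.m≤n⇒m≤1+n j≤n))) (f≈g (suc n) ℕ.≤-refl)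

  sumTo-unfoldˡ : ∀ n (f : ℕ → Carrier) → sumTo (suc n) f ≈ f 0 + sumTo n (f ∘ suc)
  sumTo-unfoldˡ zero    f = refl
  sumTo-unfoldˡ (suc n) f = trans (+-congʳ (sumTo-unfoldˡ n f)) (+-assoc _ _ _)

  sumTo≈∑ : ∀ n (f : ℕ → Carrier) → sumTo n f ≈ ∑[ i ≤ n ] f (toℕ i)
  sumTo≈∑ zero    f = sym (+-identityʳ (f 0))
  sumTo≈∑ (suc n) f = trans (sumTo-unfoldˡ n f) (+-congˡ (sumTo≈∑ n (f ∘ suc)))

  sumTo-distrib-+ : ∀ n (f g : ℕ → Carrier) →
                    sumTo n (λ j → f j + g j) ≈ sumTo n f + sumTo n g
  sumTo-distrib-+ n f g = begin
    sumTo n (λ j → f j + g j)                      ≈⟨ sumTo≈∑ n _ ⟩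
    ∑[ i ≤ n ] (f (toℕ i) + g (toℕ i))             ≈⟨ ∑-distrib-+ {suc n} (f ∘ toℕ) (g ∘ toℕ) ⟩
    ∑[ i ≤ n ] f (toℕ i) + ∑[ i ≤ n ] g (toℕ i)    ≈⟨ +-cong (sumTo≈∑ n f) (sumTo≈∑ n g) ⟨
    sumTo n f + sumTo n g                          ∎

  *-distribˡ-sumTo : ∀ n a (f : ℕ → Carrier) → a * sumTo n f ≈ sumTo n (λ j → a * f j)
  *-distribˡ-sumTo n a f =
    trans (*-congˡ (sumTo≈∑ n f)) (trans (*-distribˡ-sum {suc n} a (f ∘ toℕ)) (sym (sumTo≈∑ n _)))

  *-distribʳ-sumTo : ∀ n a (f : ℕ → Carrier) → sumTo n f * a ≈ sumTo n (λ j → f j * a)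
  *-distribʳ-sumTo n a f =
    trans (*-congʳ (sumTo≈∑ n f)) (trans (*-distribʳ-sum {suc n} a (f ∘ toℕ)) (sym (sumTo≈∑ n _)))

  -‿sumTo : ∀ n (f : ℕ → Carrier) → - sumTo n f ≈ sumTo n (λ j → - f j)
  -‿sumTo n f = begin
    - sumTo n f                     ≈⟨ -1*x≈-x _ ⟨
    - 1# * sumTo n f                ≈⟨ *-distribˡ-sumTo n (- 1#) f ⟩
    sumTo n (λ j → - 1# * f j)      ≈⟨ sumTo-cong n (λ j → -1*x≈-x (f j)) ⟩
    sumTo n (λ j → - f j)           ∎

  _Cᴿ_ : ℕ → ℕ → Carrier
  n Cᴿ j = (n C j) × 1#

  ×≈×1#* : ∀ n x → n × x ≈ (n × 1#) * x
  ×≈×1#* n x = sym (trans (×-assoc-* n 1# x) (×-congʳ n (*-identityˡ x)))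

  Cᴿ-pascal : ∀ n j → suc n Cᴿ suc j ≈ n Cᴿ j + n Cᴿ suc j
  Cᴿ-pascal n j =
    trans (×-congˡ (≡.sym (nCk+nC[k+1]≡[n+1]C[k+1] n j))) (×-homo-+ 1# (n C j) (n C suc j))

  nCᴿ[1+n]≈0 : ∀ n → n Cᴿ suc n ≈ 0#
  nCᴿ[1+n]≈0 n = ×-congˡ (k>n⇒nCk≡0 (ℕ.n<1+n n))

  sumTo-pascal : ∀ n (h : ℕ → Carrier) →
    sumTo (suc n) (λ j → suc n Cᴿ j * h j)
      ≈ sumTo n (λ j → n Cᴿ j * h j) + sumTo n (λ j → n Cᴿ j * h (suc j))
  sumTo-pascal n h = begin
    sumTo (suc n) (λ j → suc n Cᴿ j * h j)
      ≈⟨ sumTo-unfoldˡ n _ ⟩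
    n Cᴿ 0 * h 0 + sumTo n (λ j → suc n Cᴿ suc j * h (suc j))
      ≈⟨ +-congˡ (sumTo-cong n (λ j → trans (*-congʳ (Cᴿ-pascal n j)) (distribʳ _ _ _))) ⟩
    n Cᴿ 0 * h 0 + sumTo n (λ j → n Cᴿ j * h (suc j) + n Cᴿ suc j * h (suc j))
      ≈⟨ +-congˡ (trans (sumTo-distrib-+ n _ _) (+-comm _ _)) ⟩
    n Cᴿ 0 * h 0 + (sumTo n (λ j → n Cᴿ suc j * h (suc j)) + shifted)
      ≈⟨ +-assoc _ _ _ ⟨
    (n Cᴿ 0 * h 0 + sumTo n (λ j → n Cᴿ suc j * h (suc j))) + shifted
      ≈⟨ +-congʳ (sumTo-unfoldˡ n _) ⟨
    (sumTo n (λ j → n Cᴿ j * h j) + n Cᴿ suc n * h (suc n)) + shifted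
      ≈⟨ +-congʳ (+-congˡ (trans (*-congʳ (nCᴿ[1+n]≈0 n)) (zeroˡ _))) ⟩
    (sumTo n (λ j → n Cᴿ j * h j) + 0#) + shifted
      ≈⟨ +-congʳ (+-identityʳ _) ⟩
    sumTo n (λ j → n Cᴿ j * h j) + shifted
      ∎
    where
    shifted : Carrier
    shifted = sumTo n (λ j → n Cᴿ j * h (suc j))

  binomial-theorem : ∀ n x y → (x + y) ^ n ≈ sumTo n (λ j → n Cᴿ j * (x ^ j * y ^ (n ∸ j)))
  binomial-theorem n x y = begin
    (x + y) ^ n
      ≈⟨ Binomial.theorem commutativeSemiring n x y ⟩
    ∑[ i ≤ n ] ((n C toℕ i) × (x ^ toℕ i * y ^ (n ∸ toℕ i)))
      ≈⟨ sumTo≈∑ n _ ⟨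
    sumTo n (λ j → (n C j) × (x ^ j * y ^ (n ∸ j)))
      ≈⟨ sumTo-cong n (λ j → ×≈×1#* (n C j) _) ⟩
    sumTo n (λ j → n Cᴿ j * (x ^ j * y ^ (n ∸ j)))
      ∎

  Δ : ℕ → (ℕ → Carrier) → ℕ → Carrier
  Δ zero    f x = f x
  Δ (suc n) f x = Δ n f (suc x) - Δ n f x

  alternatingSum : ℕ → (ℕ → Carrier) → ℕ → Carrier
  alternatingSum n f x = sumTo n (λ j → sign j * (n Cᴿ j * f (x ℕ.+ (n ∸ j))))

  alternatingSum-suc : ∀ n f x →
    alternatingSum (suc n) f x ≈ alternatingSum n f (suc x) - alternatingSum n f x
  alternatingSum-suc n f x = begin
    alternatingSum (suc n) f x
      ≈⟨ sumTo-cong (suc n) (λ j → x∙yz≈y∙xz _ _ _) ⟩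
    sumTo (suc n) (λ j → suc n Cᴿ j * h j)
      ≈⟨ sumTo-pascal n h ⟩
    sumTo n (λ j → n Cᴿ j * h j) + sumTo n (λ j → n Cᴿ j * h (suc j))
      ≈⟨ +-cong (sumTo-cong-≤ n (λ j j≤n → trans (x∙yz≈y∙xz _ _ _)
                   (*-congˡ (*-congˡ (reflexive (≡.cong f (shift j j≤n)))))))
                (sumTo-cong n (λ j → trans (x∙yz≈y∙xz _ _ _) (trans (*-assoc _ _ _) (-1*x≈-x _)))) ⟩
    alternatingSum n f (suc x) + sumTo n (λ j → - (sign j * (n Cᴿ j * f (x ℕ.+ (n ∸ j)))))
      ≈⟨ +-congˡ (-‿sumTo n _) ⟨
    alternatingSum n f (suc x) - alternatingSum n f x
      ∎
    where
    h : ℕ → Carrier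
    h j = sign j * f (x ℕ.+ (suc n ∸ j))
    shift : ∀ j → j ≤ n → x ℕ.+ (suc n ∸ j) ≡ suc x ℕ.+ (n ∸ j)
    shift j j≤n = ≡.trans (≡.cong (x ℕ.+_) (ℕ.+-∸-assoc 1 j≤n)) (ℕ.+-suc x (n ∸ j))

  Δ≈alternatingSum : ∀ n f x → Δ n f x ≈ alternatingSum n f x
  Δ≈alternatingSum zero f x = sym (begin
    1# * ((1# + 0#) * f (x ℕ.+ 0))   ≈⟨ *-identityˡ _ ⟩
    (1# + 0#) * f (x ℕ.+ 0)          ≈⟨ *-congʳ (+-identityʳ 1#) ⟩
    1# * f (x ℕ.+ 0)                 ≈⟨ *-identityˡ _ ⟩
    f (x ℕ.+ 0)                      ≡⟨ ≡.cong f (ℕ.+-identityʳ x) ⟩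
    f x                              ∎)
  Δ≈alternatingSum (suc n) f x = trans
    (+-cong (Δ≈alternatingSum n f (suc x)) (-‿cong (Δ≈alternatingSum n f x)))
    (sym (alternatingSum-suc n f x))

  Δ-cong : ∀ n {f g : ℕ → Carrier} → (∀ t → f t ≈ g t) → ∀ x → Δ n f x ≈ Δ n g x
  Δ-cong zero    f≈g x = f≈g x
  Δ-cong (suc n) f≈g x = +-cong (Δ-cong n f≈g (suc x)) (-‿cong (Δ-cong n f≈g x))

  Δ-+ : ∀ k μ f x → Δ (k ℕ.+ μ) f x ≡ Δ k (Δ μ f) x
  Δ-+ zero    μ f x = ≡.refl
  Δ-+ (suc k) μ f x = ≡.cong₂ _-_ (Δ-+ k μ f (suc x)) (Δ-+ k μ f x)

  Δ-translate : ∀ n f x y → Δ n f (x ℕ.+ y) ≡ Δ n (λ t → f (t ℕ.+ y)) x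
  Δ-translate zero    f x y = ≡.refl
  Δ-translate (suc n) f x y = ≡.cong₂ _-_ (Δ-translate n f (suc x) y) (Δ-translate n f x y)

  Δ-+-separate : ∀ k μ f → Δ (k ℕ.+ μ) f 0 ≈ Δ k (λ y → Δ μ (λ t → f (t ℕ.+ y)) 0) 0
  Δ-+-separate k μ f = trans (reflexive (Δ-+ k μ f 0))
                             (Δ-cong k (λ y → reflexive (Δ-translate μ f 0 y)) 0)

  Δ-sumTo : ∀ n m (F : ℕ → ℕ → Carrier) x →
            Δ n (λ t → sumTo m (λ i → F i t)) x ≈ sumTo m (λ i → Δ n (F i) x)
  Δ-sumTo zero    m F x = refl
  Δ-sumTo (suc n) m F x = begin
    Δ n (λ t → sumTo m (λ i → F i t)) (suc x) - Δ n (λ t → sumTo m (λ i → F i t)) x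
      ≈⟨ +-cong (Δ-sumTo n m F (suc x)) (-‿cong (Δ-sumTo n m F x)) ⟩
    sumTo m (λ i → Δ n (F i) (suc x)) - sumTo m (λ i → Δ n (F i) x)
      ≈⟨ +-congˡ (-‿sumTo m _) ⟩
    sumTo m (λ i → Δ n (F i) (suc x)) + sumTo m (λ i → - Δ n (F i) x)
      ≈⟨ sumTo-distrib-+ m _ _ ⟨
    sumTo m (λ i → Δ (suc n) (F i) x)
      ∎

  Δ-*ˡ : ∀ n a (f : ℕ → Carrier) x → Δ n (λ t → a * f t) x ≈ a * Δ n f x
  Δ-*ˡ zero    a f x = refl
  Δ-*ˡ (suc n) a f x = begin
    Δ n (λ t → a * f t) (suc x) - Δ n (λ t → a * f t) x
      ≈⟨ +-cong (Δ-*ˡ n a f (suc x)) (-‿cong (Δ-*ˡ n a f x)) ⟩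
    a * Δ n f (suc x) - a * Δ n f x
      ≈⟨ +-congˡ (-‿distribʳ-* _ _) ⟩
    a * Δ n f (suc x) + a * (- Δ n f x)
      ≈⟨ distribˡ _ _ _ ⟨
    a * Δ (suc n) f x
      ∎

  Δ-*ʳ : ∀ n a (f : ℕ → Carrier) x → Δ n (λ t → f t * a) x ≈ Δ n f x * a
  Δ-*ʳ n a f x = trans (Δ-cong n (λ t → *-comm _ _) x) (trans (Δ-*ˡ n a f x) (*-comm _ _))

  Cᴿ*invFact : ∀ (invFact : ℕ → Carrier) → (∀ n → IsInvFact n (invFact n)) →
               ∀ {n k} → k ≤ n → n Cᴿ k * invFact n ≈ invFact k * invFact (n ∸ k)
  Cᴿ*invFact invFact isInvFact {n} {k} k≤n = begin
    n Cᴿ k * n⁻¹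
      ≈⟨ *-identityʳ _ ⟨
    (n Cᴿ k * n⁻¹) * 1#
      ≈⟨ *-congˡ (trans (*-cong (isInvFact k) (isInvFact (n ∸ k))) (*-identityˡ 1#)) ⟨
    (n Cᴿ k * n⁻¹) * (((k !) × 1# * k⁻¹) * (((n ∸ k) !) × 1# * m⁻¹))
      ≈⟨ solve 6 (λ c i k! x m! y → (c ⊗ i) ⊗ ((k! ⊗ x) ⊗ (m! ⊗ y))
                                    ⊜ ((c ⊗ (k! ⊗ m!)) ⊗ i) ⊗ (x ⊗ y))
                 refl (n Cᴿ k) n⁻¹ ((k !) × 1#) k⁻¹ (((n ∸ k) !) × 1#) m⁻¹ ⟩
    ((n Cᴿ k * ((k !) × 1# * ((n ∸ k) !) × 1#)) * n⁻¹) * (k⁻¹ * m⁻¹)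
      ≈⟨ *-congʳ (*-congʳ n!ᴿ≈nCᴿk*k!ᴿ*[n∸k]!ᴿ) ⟨
    ((n !) × 1# * n⁻¹) * (k⁻¹ * m⁻¹)
      ≈⟨ *-congʳ (isInvFact n) ⟩
    1# * (k⁻¹ * m⁻¹)
      ≈⟨ *-identityˡ _ ⟩
    k⁻¹ * m⁻¹
      ∎
    where
    n⁻¹ k⁻¹ m⁻¹ : Carrier
    n⁻¹ = invFact n
    k⁻¹ = invFact k
    m⁻¹ = invFact (n ∸ k)
    n!ᴿ≈nCᴿk*k!ᴿ*[n∸k]!ᴿ : (n !) × 1# ≈ n Cᴿ k * ((k !) × 1# * ((n ∸ k) !) × 1#)
    n!ᴿ≈nCᴿk*k!ᴿ*[n∸k]!ᴿ = trans (×-congˡ (n!≡nCk*[k!*[n∸k]!] k≤n))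
      (trans (×1-homo-* (n C k) _) (*-congˡ (×1-homo-* (k !) ((n ∸ k) !))))

  module StirlingPolynomial (a₁ a₂ : Carrier) (p₁ p₂ : ℕ) where

    poly : (b₁ b₂ : Carrier) (q₁ q₂ : ℕ) → ℕ → Carrier
    poly b₁ b₂ q₁ q₂ z = (a₁ * (z × 1#) + b₁) ^ q₁ * (a₂ * (z × 1#) + b₂) ^ q₂

    binomialDoubleSum : (ℕ → ℕ → Carrier) → Carrier
    binomialDoubleSum W = sumTo p₂ (λ j₂ → sumTo p₁ (λ j₁ → p₁ Cᴿ j₁ * (p₂ Cᴿ j₂ * W j₁ j₂)))

    binomialDoubleSum-cong : ∀ {V W : ℕ → ℕ → Carrier} → (∀ j₁ j₂ → V j₁ j₂ ≈ W j₁ j₂) →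
                             binomialDoubleSum V ≈ binomialDoubleSum W
    binomialDoubleSum-cong V≈W =
      sumTo-cong p₂ (λ j₂ → sumTo-cong p₁ (λ j₁ → *-congˡ (*-congˡ (V≈W j₁ j₂))))

    *-distribˡ-binomialDoubleSum : ∀ a (W : ℕ → ℕ → Carrier) →
      a * binomialDoubleSum W ≈ binomialDoubleSum (λ j₁ j₂ → a * W j₁ j₂)
    *-distribˡ-binomialDoubleSum a W =
      trans (*-distribˡ-sumTo p₂ a _) (sumTo-cong p₂ (λ j₂ →
        trans (*-distribˡ-sumTo p₁ a _) (sumTo-cong p₁ (λ j₁ →
          trans (x∙yz≈y∙xz _ _ _) (*-congˡ (x∙yz≈y∙xz _ _ _))))))

    Δ-binomialDoubleSum : ∀ n (W : ℕ → ℕ → ℕ → Carrier) x →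
      Δ n (λ t → binomialDoubleSum (λ j₁ j₂ → W j₁ j₂ t)) x
        ≈ binomialDoubleSum (λ j₁ j₂ → Δ n (W j₁ j₂) x)
    Δ-binomialDoubleSum n W x =
      trans (Δ-sumTo n p₂ _ x) (sumTo-cong p₂ (λ j₂ →
        trans (Δ-sumTo n p₁ _ x) (sumTo-cong p₁ (λ j₁ →
          trans (Δ-*ˡ n _ _ x) (*-congˡ (Δ-*ˡ n _ _ x))))))

    affine-+ : ∀ a b t y → a * ((t ℕ.+ y) × 1#) + b ≈ (a * (y × 1#) + b) + (a * (t × 1#) + 0#)
    affine-+ a b t y = begin
      a * ((t ℕ.+ y) × 1#) + b                  ≈⟨ +-congʳ (*-congˡ (×-homo-+ 1# t y)) ⟩
      a * (t × 1# + y × 1#) + b                 ≈⟨ +-congʳ (distribˡ a _ _) ⟩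
      (a * (t × 1#) + a * (y × 1#)) + b         ≈⟨ +-solve 3 (λ at ay b → (at ⊕ ay) ⊕ b ⊜⁺ (ay ⊕ b) ⊕ (at ⊕ ε))
                                                     refl (a * (t × 1#)) (a * (y × 1#)) b ⟩
      (a * (y × 1#) + b) + (a * (t × 1#) + 0#)  ∎

    poly-split : ∀ b₁ b₂ t y →
      poly b₁ b₂ p₁ p₂ (t ℕ.+ y)
        ≈ binomialDoubleSum (λ j₁ j₂ → poly 0# 0# (p₁ ∸ j₁) (p₂ ∸ j₂) t * poly b₁ b₂ j₁ j₂ y)
    poly-split b₁ b₂ t y = begin
      poly b₁ b₂ p₁ p₂ (t ℕ.+ y)
        ≈⟨ *-cong (trans (^-congˡ p₁ (affine-+ a₁ b₁ t y)) (binomial-theorem p₁ _ _))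
                  (trans (^-congˡ p₂ (affine-+ a₂ b₂ t y)) (binomial-theorem p₂ _ _)) ⟩
      sumTo p₁ A * sumTo p₂ B
        ≈⟨ *-distribˡ-sumTo p₂ _ B ⟩
      sumTo p₂ (λ j₂ → sumTo p₁ A * B j₂)
        ≈⟨ sumTo-cong p₂ (λ j₂ → trans (*-distribʳ-sumTo p₁ (B j₂) A) (sumTo-cong p₁ (λ j₁ →
             solve 6 (λ c₁ h₁ g₁ c₂ h₂ g₂ → (c₁ ⊗ (h₁ ⊗ g₁)) ⊗ (c₂ ⊗ (h₂ ⊗ g₂))
                                           ⊜ c₁ ⊗ (c₂ ⊗ ((g₁ ⊗ g₂) ⊗ (h₁ ⊗ h₂))))
                     refl _ _ _ _ _ _))) ⟩
      binomialDoubleSum (λ j₁ j₂ → poly 0# 0# (p₁ ∸ j₁) (p₂ ∸ j₂) t * poly b₁ b₂ j₁ j₂ y)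
        ∎
      where
      A : ℕ → Carrier
      A j₁ = p₁ Cᴿ j₁ * ((a₁ * (y × 1#) + b₁) ^ j₁ * (a₁ * (t × 1#) + 0#) ^ (p₁ ∸ j₁))
      B : ℕ → Carrier
      B j₂ = p₂ Cᴿ j₂ * ((a₂ * (y × 1#) + b₂) ^ j₂ * (a₂ * (t × 1#) + 0#) ^ (p₂ ∸ j₂))

    Δ[k+μ]poly : ∀ b₁ b₂ k μ →
      Δ (k ℕ.+ μ) (poly b₁ b₂ p₁ p₂) 0
        ≈ binomialDoubleSum (λ j₁ j₂ → Δ μ (poly 0# 0# (p₁ ∸ j₁) (p₂ ∸ j₂)) 0
                                       * Δ k (poly b₁ b₂ j₁ j₂) 0)
    Δ[k+μ]poly b₁ b₂ k μ = begin
      Δ (k ℕ.+ μ) (poly b₁ b₂ p₁ p₂) 0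
        ≈⟨ Δ-+-separate k μ _ ⟩
      Δ k (λ y → Δ μ (λ t → poly b₁ b₂ p₁ p₂ (t ℕ.+ y)) 0) 0
        ≈⟨ Δ-cong k (λ y → trans (Δ-cong μ (λ t → poly-split b₁ b₂ t y) 0)
                       (trans (Δ-binomialDoubleSum μ _ 0)
                              (binomialDoubleSum-cong (λ j₁ j₂ → Δ-*ʳ μ _ _ 0)))) 0 ⟩
      Δ k (λ y → binomialDoubleSum (λ j₁ j₂ → G j₁ j₂ * poly b₁ b₂ j₁ j₂ y)) 0
        ≈⟨ Δ-binomialDoubleSum k _ 0 ⟩
      binomialDoubleSum (λ j₁ j₂ → Δ k (λ y → G j₁ j₂ * poly b₁ b₂ j₁ j₂ y) 0)
        ≈⟨ binomialDoubleSum-cong (λ j₁ j₂ → Δ-*ˡ k _ _ 0) ⟩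
      binomialDoubleSum (λ j₁ j₂ → G j₁ j₂ * Δ k (poly b₁ b₂ j₁ j₂) 0)
        ∎
      where
      G : ℕ → ℕ → Carrier
      G j₁ j₂ = Δ μ (poly 0# 0# (p₁ ∸ j₁) (p₂ ∸ j₂)) 0

open import Data.Nat using (_+_)

mainTheorem12 : {c ℓ : Level} (R : CommutativeRing c ℓ) →
    let open CommutativeRing R renaming (_+_ to _+R_) in
    let open GenStirling R in
    (invFact : ℕ → Carrier) → (∀ n → IsInvFact n (invFact n)) →
    (a₁ b₁ a₂ b₂ : Carrier) (p₁ p₂ k μ : ℕ) →
    ((k + μ) C k) × S invFact a₁ b₁ a₂ b₂ p₂ p₁ (k + μ)
      ≈ sumTo p₂ (λ j₂ → sumTo p₁ (λ j₁ →
          ((p₁ C j₁) × 1#) * (((p₂ C j₂) × 1#) *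
            (S invFact a₁ 0# a₂ 0# (p₂ ∸ j₂) (p₁ ∸ j₁) μ
              * S invFact a₁ b₁ a₂ b₂ j₂ j₁ k))))
-- S k unfolds definitionally to invFact k * alternatingSum k (poly …) 0, so the ends of the chain
-- are the two sides of the statement.
mainTheorem12 R invFact isInvFact a₁ b₁ a₂ b₂ p₁ p₂ k μ = begin
  ((k + μ) C k) × (invFact (k + μ) * alternatingSum (k + μ) f 0)
    ≈⟨ trans (×≈×1#* ((k + μ) C k) _) (sym (*-assoc _ _ _)) ⟩
  ((k + μ) Cᴿ k * invFact (k + μ)) * alternatingSum (k + μ) f 0
    ≈⟨ *-cong Cᴿ*invFact[k+μ] (sym (Δ≈alternatingSum (k + μ) f 0)) ⟩
  (invFact μ * invFact k) * Δ (k + μ) f 0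
    ≈⟨ *-congˡ (Δ[k+μ]poly b₁ b₂ k μ) ⟩
  (invFact μ * invFact k) * binomialDoubleSum (λ j₁ j₂ → Δ μ (g j₁ j₂) 0 * Δ k (h j₁ j₂) 0)
    ≈⟨ *-distribˡ-binomialDoubleSum _ _ ⟩
  binomialDoubleSum (λ j₁ j₂ → (invFact μ * invFact k) * (Δ μ (g j₁ j₂) 0 * Δ k (h j₁ j₂) 0))
    ≈⟨ binomialDoubleSum-cong (λ j₁ j₂ → trans (interchange _ _ _ _)
         (*-cong (*-congˡ (Δ≈alternatingSum μ _ 0)) (*-congˡ (Δ≈alternatingSum k _ 0)))) ⟩
  binomialDoubleSum (λ j₁ j₂ → S invFact a₁ 0# a₂ 0# (p₂ ∸ j₂) (p₁ ∸ j₁) μ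
                               * S invFact a₁ b₁ a₂ b₂ j₂ j₁ k)
    ∎
  where
  open CommutativeRing R hiding (_+_)
  open GenStirling R
  open GenStirlingProperties R
  open StirlingPolynomial a₁ a₂ p₁ p₂
  open SetoidReasoning setoid
  open CommutativeSemigroupProperties *-commutativeSemigroup using (interchange)

  f : ℕ → Carrier
  f = poly b₁ b₂ p₁ p₂
  g h : ℕ → ℕ → ℕ → Carrier
  g j₁ j₂ = poly 0# 0# (p₁ ∸ j₁) (p₂ ∸ j₂)
  h j₁ j₂ = poly b₁ b₂ j₁ j₂

  Cᴿ*invFact[k+μ] : (k + μ) Cᴿ k * invFact (k + μ) ≈ invFact μ * invFact k
  Cᴿ*invFact[k+μ] = trans (Cᴿ*invFact invFact isInvFact (ℕ.m≤m+n k μ))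
    (trans (*-congˡ (reflexive (≡.cong invFact (ℕ.m+n∸m≡n k μ)))) (*-comm _ _))
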